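{- Let $T$ be a tree with at least two vertices in which the distance between any two pendant vertices is even, and let $F(T)$ be its set of vertices of degree $1$. If $|F(T)|>M(T)+2$, then $\widetilde{T}\notin\mathfrak{N}$.
   Context: All graphs are finite, without loops or multiple edges. An interval $t$-coloring of a graph $G$ is a proper edge-coloring of $G$ with colors $1,\ldots,t$ such that every color is used and for every vertex $v$ the set of colors of edges incident to $v$ is an interval of integers. $\mathfrak{N}$ denotes the set of graphs having an interval $t$-coloring for some positive integer $t$. For a tree $T$ with vertices $v_1,\ldots,v_n$ ($n\geq2$) and vertices $v_i,v_j$, let $P(v_i,v_j)$ be the unique path joining them, with vertex set $VP(v_i,v_j)$ and edge set $EP(v_i,v_j)$, and define $L(v_i,v_j)=|EP(v_i,v_j)|+|\{uw\in E(T): u\in VP(v_i,v_j), w\notin VP(v_i,v_j)\}|$ and $M(T)=\max_{1\leq i,j\leq n}L(v_i,v_j)$. The graph $\widetilde{T}$ is obtained from $T$ by adding a new vertex $u$ and joining $u$ to every vertex of $F(T)$; it is a connected bipartite graph with maximum degree $|F(T)|$. -}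

module Defs where

open import Data.Nat using (ℕ; zero; suc; _+_; _∸_; _≤_; _<_)
open import Data.Fin using (Fin; zero; suc)
open import Data.Fin.Properties using (_≟_)
open import Data.Bool using (Bool; true; false; if_then_else_; not)
open import Data.List using (List; []; _∷_; length; map; allFin)
open import Data.Nat.ListAction using (sum)
open import Data.List.Relation.Unary.Unique.Propositional using (Unique)
open import Data.Product using (Σ; ∃; ∃-syntax; _×_; _,_)
open import Relation.Binary.PropositionalEquality using (_≡_; _≢_)
open import Relation.Nullary using (¬_; does)
open import Function.Bundles using (_⇔_)

Graph : ℕ → Set
Graph n = Fin n → Fin n → Bool

Adj : ∀ {n} → Graph n → Fin n → Fin n → Set
Adj G u v = G u v ≡ true

IsSimple : ∀ {n} → Graph n → Set
IsSimple {n} G = (∀ u v → G u v ≡ G v u) × (∀ v → G v v ≡ false)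

deg : ∀ {n} → Graph n → Fin n → ℕ
deg {n} G v = sum (map (λ w → if G v w then 1 else 0) (allFin n))

Pendant : ∀ {n} → Graph n → Fin n → Set
Pendant G v = deg G v ≡ 1

numPendant : ∀ {n} → Graph n → ℕ
numPendant {n} G = sum (map (λ v → if does (deg G v Data.Nat.≟ 1) then 1 else 0) (allFin n))

data Walk {n} (G : Graph n) : Fin n → Fin n → List (Fin n) → Set where
  here : ∀ v → Walk G v v (v ∷ [])
  step : ∀ {u v w vs} → Adj G u v → Walk G v w vs → Walk G u w (u ∷ vs)

IsPath : ∀ {n} → Graph n → Fin n → Fin n → List (Fin n) → Set
IsPath G u v vs = Walk G u v vs × Unique vs

IsCycle : ∀ {n} → Graph n → List (Fin n) → Set
IsCycle G vs = ∃[ u ] ∃[ v ] (IsPath G u v vs × 3 ≤ length vs × Adj G v u)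

Connected : ∀ {n} → Graph n → Set
Connected {n} G = ∀ (u v : Fin n) → ∃[ vs ] Walk G u v vs

Acyclic : ∀ {n} → Graph n → Set
Acyclic G = ∀ vs → ¬ IsCycle G vs

IsTree : ∀ {n} → Graph n → Set
IsTree G = IsSimple G × Connected G × Acyclic G

-- distance: d = number of edges of a shortest walk from u to v
Dist : ∀ {n} → Graph n → Fin n → Fin n → ℕ → Set
Dist G u v d =
  (∃[ vs ] (Walk G u v vs × length vs ≡ suc d)) ×
  (∀ vs → Walk G u v vs → suc d ≤ length vs)

elem : ∀ {n} → Fin n → List (Fin n) → Bool
elem x [] = false
elem x (y ∷ ys) = if does (x ≟ y) then true else elem x ys

-- L for the path with vertex list vs:
-- |EP| + |{uw ∈ E : u ∈ VP, w ∉ VP}|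
Lpath : ∀ {n} → Graph n → List (Fin n) → ℕ
Lpath {n} G vs =
  (length vs ∸ 1) +
  sum (map (λ u → sum (map (λ w → if G u w then (if elem w vs then 0 else 1) else 0)
                           (allFin n))) vs)

-- L(v_i, v_j) = l, where P is the (unique, in a tree) path from v_i to v_j
IsL : ∀ {n} → Graph n → Fin n → Fin n → ℕ → Set
IsL G i j l = ∃[ vs ] (IsPath G i j vs × Lpath G vs ≡ l)

IsM : ∀ {n} → Graph n → ℕ → Set
IsM {n} G m =
  (∃[ i ] ∃[ j ] IsL G i j m) ×
  (∀ (i j : Fin n) l → IsL G i j l → l ≤ m)

-- T̃: new vertex zero joined to every pendant vertex of T (old vertices are suc v)
tilde : ∀ {n} → Graph n → Graph (suc n)
tilde G zero zero = false
tilde G zero (suc v) = does (deg G v Data.Nat.≟ 1)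
tilde G (suc v) zero = does (deg G v Data.Nat.≟ 1)
tilde G (suc u) (suc v) = G u v

record IntervalColoring {n} (G : Graph n) (t : ℕ) : Set where
  field
    c        : Fin n → Fin n → ℕ
    sym      : ∀ u v → Adj G u v → c u v ≡ c v u
    range    : ∀ u v → Adj G u v → 1 ≤ c u v × c u v ≤ t
    proper   : ∀ u v w → Adj G u v → Adj G u w → v ≢ w → c u v ≢ c u w
    allUsed  : ∀ k → 1 ≤ k → k ≤ t → ∃[ u ] ∃[ v ] (Adj G u v × c u v ≡ k)
    interval : ∀ v → ∃[ a ] ∃[ b ]
                 (∀ k → (a ≤ k × k ≤ b) ⇔ (∃[ w ] (Adj G v w × c v w ≡ k)))

InN : ∀ {n} → Graph n → Set
InN G = ∃[ t ] (1 ≤ t × IntervalColoring G t)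

module Submission where

-- Suppose T̃ (T plus an apex 0 joined to the pendant vertices) had an
-- interval colouring.  (1) The colours at a vertex v are a, …, b, each once,
-- so deg v = b − a + 1 and two colours at v differ by ≤ deg v − 1.
-- (2) Hence along a walk v₀ … vₖ an edge colour at vₖ exceeds one at v₀
-- by at most Σᵢ (deg vᵢ − 1).  (3) The apex edges 0x, 0y of extreme colour
-- differ by |F(T)| − 1.  Join x, y by an induced path P of T: each vertex of
-- P has ≤ 2 neighbours on P and pendant vertices gain one edge in T̃, so
-- Σ_{v ∈ P} (deg_T̃ v − 1) ≤ |V(P)| + #(edges leaving P) = L(P) + 1 ≤ M(T) + 1.
-- So |F(T)| ≤ M(T) + 2.

open import Defs
open import Data.Nat using (ℕ; _+_; _≤_; _<_)
open import Data.Nat.Divisibility using (_∣_)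
open import Data.Fin using (Fin)
open import Relation.Nullary using (¬_)

open import Data.Nat using (zero; suc; _∸_; z≤n; s≤s; s≤s⁻¹; _≟_)
open import Data.Nat.Properties
open import Data.Nat.ListAction using (sum)
open import Data.Fin using (zero; suc)
open import Data.Fin.Properties using () renaming (_≟_ to _≟ᶠ_)
open import Data.Bool using (true; false; if_then_else_)
import Data.Bool.Properties as Bool
open import Data.List using (List; []; _∷_; length; map; allFin; filter; applyUpTo)
open import Data.List.Properties using (length-map; map-tabulate; map-∘; length-applyUpTo)
open import Data.List.Relation.Unary.All as All using (All; []; _∷_)
import Data.List.Relation.Unary.All.Properties as All
open import Data.List.Relation.Unary.Any using (here; there)
open import Data.List.Relation.Unary.AllPairs using ([]; _∷_)
open import Data.List.Relation.Unary.Unique.Propositional using (Unique)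
open import Data.List.Relation.Unary.Unique.Propositional.Properties
  using (allFin⁺; applyUpTo⁺₁; filter⁺)
open import Data.List.Membership.Propositional using (_∈_)
open import Data.List.Membership.Propositional.Properties
  using (∈-map⁺; ∈-map⁻; ∈-allFin; ∈-filter⁺; ∈-filter⁻; ∈-applyUpTo⁺; ∈-applyUpTo⁻)
open import Data.List.Relation.Binary.Subset.Propositional using (_⊆_)
open import Data.Product using (∃-syntax; _×_; _,_; proj₁; proj₂; uncurry)
open import Data.Sum using (_⊎_; inj₁; inj₂)
open import Data.Empty using (⊥-elim)
open import Relation.Binary.PropositionalEquality
open import Relation.Nullary using (does; yes; no)
open import Relation.Unary using (Decidable)
open import Function.Bundles using (_⇔_; Equivalence)
open import Algebra.Properties.CommutativeSemigroup +-commutativeSemigroup using (interchange)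

remove : ∀ {A : Set} {x : A} (ys : List A) → x ∈ ys → List A
remove (_ ∷ ys) (here _)  = ys
remove (y ∷ ys) (there p) = y ∷ remove ys p

length-remove : ∀ {A : Set} {x : A} (ys : List A) (p : x ∈ ys) →
                length ys ≡ suc (length (remove ys p))
length-remove (_ ∷ _)  (here _)  = refl
length-remove (_ ∷ ys) (there p) = cong suc (length-remove ys p)

∈-remove : ∀ {A : Set} {x w : A} (ys : List A) (p : x ∈ ys) →
           w ∈ ys → w ≢ x → w ∈ remove ys p
∈-remove (_ ∷ _)  (here refl) (here refl) w≢x = ⊥-elim (w≢x refl)
∈-remove (_ ∷ _)  (here refl) (there q)   _   = q
∈-remove (_ ∷ _)  (there p)   (here refl) _   = here refl
∈-remove (_ ∷ ys) (there p)   (there q)   w≢x = there (∈-remove ys p q w≢x)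

unique-⊆⇒length≤ : ∀ {A : Set} {xs ys : List A} → Unique xs → xs ⊆ ys →
                   length xs ≤ length ys
unique-⊆⇒length≤ {xs = []}     _            _   = z≤n
unique-⊆⇒length≤ {xs = x ∷ xs} {ys} (x∉xs ∷ xs-unique) xs⊆ys =
  subst (suc (length xs) ≤_) (sym (length-remove ys x∈ys))
    (s≤s (unique-⊆⇒length≤ xs-unique xs⊆rest))
  where
  x∈ys : x ∈ ys
  x∈ys = xs⊆ys (here refl)
  xs⊆rest : xs ⊆ remove ys x∈ys
  xs⊆rest w∈xs = ∈-remove ys x∈ys (xs⊆ys (there w∈xs))
                   (λ w≡x → All.lookup x∉xs w∈xs (sym w≡x))

sameMembers⇒length≡ : ∀ {A : Set} {xs ys : List A} → Unique xs → Unique ys →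
                      xs ⊆ ys → ys ⊆ xs → length xs ≡ length ys
sameMembers⇒length≡ xs-unique ys-unique xs⊆ys ys⊆xs =
  ≤-antisym (unique-⊆⇒length≤ xs-unique xs⊆ys) (unique-⊆⇒length≤ ys-unique ys⊆xs)

map-unique : ∀ {A B : Set} (f : A → B) {xs : List A} → Unique xs →
             (∀ {x y} → x ∈ xs → y ∈ xs → x ≢ y → f x ≢ f y) → Unique (map f xs)
map-unique f {[]}    []              _   = []
map-unique f {x ∷ _} (x∉xs ∷ unique) inj =
  All.map⁺ (All.tabulate (λ y∈xs → inj (here refl) (there y∈xs) (All.lookup x∉xs y∈xs)))
  ∷ map-unique f unique (λ p q → inj (there p) (there q))

segment : ℕ → ℕ → List ℕ
segment a b = applyUpTo (a +_) (suc (b ∸ a))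

segment-unique : ∀ a b → Unique (segment a b)
segment-unique a b =
  applyUpTo⁺₁ (a +_) (suc (b ∸ a)) (λ i<j _ eq → <⇒≢ i<j (+-cancelˡ-≡ a _ _ eq))

length-segment : ∀ a b → length (segment a b) ≡ suc (b ∸ a)
length-segment a b = length-applyUpTo (a +_) (suc (b ∸ a))

∈-segment⁺ : ∀ {a b k} → a ≤ k → k ≤ b → k ∈ segment a b
∈-segment⁺ {a} {b} a≤k k≤b =
  subst (_∈ segment a b) (m+[n∸m]≡n a≤k) (∈-applyUpTo⁺ (a +_) (s≤s (∸-monoˡ-≤ a k≤b)))

∈-segment⁻ : ∀ {a b k} → a ≤ b → k ∈ segment a b → a ≤ k × k ≤ b
∈-segment⁻ {a} a≤b k∈ with i , i≤b-a , refl ← ∈-applyUpTo⁻ (a +_) k∈ =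
  m≤m+n a i , subst (a + i ≤_) (m+[n∸m]≡n a≤b) (+-monoʳ-≤ a (s≤s⁻¹ i≤b-a))

first-member : ∀ {A : Set} {xs : List A} → 1 ≤ length xs → ∃[ x ] x ∈ xs
first-member {xs = x ∷ _} _ = x , here refl

sum-≤-+ : ∀ {A : Set} (f g h : A → ℕ) (L : List A) →
          All (λ x → f x ≤ g x + h x) L → sum (map f L) ≤ sum (map g L) + sum (map h L)
sum-≤-+ f g h []      []       = z≤n
sum-≤-+ f g h (x ∷ L) (le ∷ les) =
  ≤-trans (+-mono-≤ le (sum-≤-+ f g h L les)) (≤-reflexive (interchange (g x) (h x) _ _))

indicator≤1 : ∀ b → (if b then 1 else 0) ≤ 1
indicator≤1 true  = ≤-refl
indicator≤1 false = z≤n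

sum-ones : ∀ {A : Set} (L : List A) → sum (map (λ _ → 1) L) ≡ length L
sum-ones []      = refl
sum-ones (_ ∷ L) = cong suc (sum-ones L)

sum-zeros : ∀ {A : Set} (L : List A) → sum (map (λ _ → 0) L) ≡ 0
sum-zeros []      = refl
sum-zeros (_ ∷ L) = sum-zeros L

sum-allFin-suc : ∀ {n} (g : Fin (suc n) → ℕ) →
  sum (map g (allFin (suc n))) ≡ g zero + sum (map (λ v → g (suc v)) (allFin n))
sum-allFin-suc {n} g =
  trans (cong sum (map-tabulate (λ x → x) g))
        (cong (λ l → g zero + sum l) (sym (map-tabulate (λ x → x) (λ v → g (suc v)))))

module _ {n : ℕ} where

  sum-at : ∀ (f : Fin n → ℕ) z L → Unique L →
           sum (map (λ w → if does (w ≟ᶠ z) then f w else 0) L) ≤ f z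
  sum-at f z []      _               = z≤n
  sum-at f z (x ∷ L) (x∉L ∷ unique) with x ≟ᶠ z
  ... | yes refl = ≤-reflexive (trans (cong (f x +_) (absent L x∉L)) (+-identityʳ (f x)))
    where
    absent : ∀ L → All (x ≢_) L → sum (map (λ w → if does (w ≟ᶠ x) then f w else 0) L) ≡ 0
    absent []      []          = refl
    absent (y ∷ L) (x≢y ∷ x∉L) with y ≟ᶠ x
    ... | yes y≡x = ⊥-elim (x≢y (sym y≡x))
    ... | no _    = absent L x∉L
  ... | no _     = sum-at f z L unique

  sum-restrict : ∀ (f : Fin n → ℕ) L → Unique L → ∀ vs →
                 sum (map (λ w → if elem w vs then f w else 0) L) ≤ sum (map f vs)
  sum-restrict f L unique []       = ≤-reflexive (sum-zeros L)
  sum-restrict f L unique (z ∷ zs) =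
    ≤-trans (sum-≤-+ _ _ _ L (All.tabulate (λ {w} _ → split w)))
            (+-mono-≤ (sum-at f z L unique) (sum-restrict f L unique zs))
    where
    split : ∀ w → (if elem w (z ∷ zs) then f w else 0) ≤
                  (if does (w ≟ᶠ z) then f w else 0) + (if elem w zs then f w else 0)
    split w with does (w ≟ᶠ z)
    ... | true  = m≤m+n (f w) _
    ... | false = ≤-refl

module _ {N : ℕ} (G : Graph N) where

  adjacent? : ∀ v → Decidable (Adj G v)
  adjacent? v w = G v w Bool.≟ true

  neighbours : Fin N → List (Fin N)
  neighbours v = filter (adjacent? v) (allFin N)

  neighboursIn : Fin N → List (Fin N) → ℕ
  neighboursIn v L = sum (map (λ w → if G v w then 1 else 0) L)

  -- The number of edges from u to vertices not in vs; Lpath G vs is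
  -- (length vs ∸ 1) plus the sum of this over vs.
  outside : List (Fin N) → Fin N → ℕ
  outside vs u = sum (map (λ w → if G u w then (if elem w vs then 0 else 1) else 0) (allFin N))

  length-neighbours : ∀ v → length (neighbours v) ≡ deg G v
  length-neighbours v = count (allFin N)
    where
    count : ∀ L → length (filter (adjacent? v) L) ≡ neighboursIn v L
    count []      = refl
    count (x ∷ L) with G v x
    ... | true  = cong suc (count L)
    ... | false = count L

  ∈-neighbours⁺ : ∀ {v w} → Adj G v w → w ∈ neighbours v
  ∈-neighbours⁺ {v} {w} vw = ∈-filter⁺ (adjacent? v) (∈-allFin w) vw

  ∈-neighbours⁻ : ∀ {v w} → w ∈ neighbours v → Adj G v w
  ∈-neighbours⁻ {v} w∈ = proj₂ (∈-filter⁻ (adjacent? v) {xs = allFin N} w∈)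

  neighbours-unique : ∀ v → Unique (neighbours v)
  neighbours-unique v = filter⁺ (adjacent? v) (allFin⁺ N)

  has-neighbour : ∀ v → 1 ≤ deg G v → ∃[ w ] Adj G v w
  has-neighbour v 1≤deg with w , w∈ ← first-member (subst (1 ≤_) (sym (length-neighbours v)) 1≤deg) =
    w , ∈-neighbours⁻ w∈

  deg≤inside+outside : ∀ v vs → deg G v ≤ neighboursIn v vs + outside vs v
  deg≤inside+outside v vs =
    ≤-trans (sum-≤-+ _ _ _ (allFin N) (All.tabulate (λ {w} _ → split w)))
            (+-monoˡ-≤ (outside vs v)
              (sum-restrict (λ w → if G v w then 1 else 0) (allFin N) (allFin⁺ N) vs))
    where
    split : ∀ w → (if G v w then 1 else 0) ≤
                  (if elem w vs then (if G v w then 1 else 0) else 0) +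
                  (if G v w then (if elem w vs then 0 else 1) else 0)
    split w with G v w | elem w vs
    ... | true  | true  = ≤-refl
    ... | true  | false = ≤-refl
    ... | false | _     = z≤n

  -- Σ (deg v − 1) over the vertices of vs: the colour budget of a walk.
  excess : List (Fin N) → ℕ
  excess vs = sum (map (λ v → deg G v ∸ 1) vs)

-- Interval colourings: the colour estimates (1) and (2)

module ColourFacts {N : ℕ} {G : Graph N} {t : ℕ} (col : IntervalColoring G t) where
  open IntervalColoring col using (c; proper; interval) renaming (sym to c-sym)

  Spans : Fin N → ℕ → ℕ → Set
  Spans v a b = ∀ k → (a ≤ k × k ≤ b) ⇔ (∃[ w ] (Adj G v w × c v w ≡ k))

  coloursAt : Fin N → List ℕ
  coloursAt v = map (c v) (neighbours G v)

  coloursAt-unique : ∀ v → Unique (coloursAt v)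
  coloursAt-unique v = map-unique (c v) (neighbours-unique G v)
    (λ p q → proper v _ _ (∈-neighbours⁻ G p) (∈-neighbours⁻ G q))

  deg≡span : ∀ {v a b} → Spans v a b → a ≤ b → deg G v ≡ suc (b ∸ a)
  deg≡span {v} {a} {b} spans a≤b = begin
    deg G v                 ≡⟨ sym (length-neighbours G v) ⟩
    length (neighbours G v) ≡⟨ sym (length-map (c v) (neighbours G v)) ⟩
    length (coloursAt v)    ≡⟨ sameMembers⇒length≡ (coloursAt-unique v) (segment-unique a b)
                                 colour⇒inSegment inSegment⇒colour ⟩
    length (segment a b)   ≡⟨ length-segment a b ⟩
    suc (b ∸ a)             ∎
    where
    open ≡-Reasoning
    colour⇒inSegment : coloursAt v ⊆ segment a b
    colour⇒inSegment k∈ with w , w∈ , refl ← ∈-map⁻ (c v) k∈ =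
      uncurry ∈-segment⁺ (Equivalence.from (spans _) (w , ∈-neighbours⁻ G w∈ , refl))
    inSegment⇒colour : segment a b ⊆ coloursAt v
    inSegment⇒colour k∈ with w , vw , refl ← Equivalence.to (spans _) (∈-segment⁻ a≤b k∈) =
      ∈-map⁺ (c v) (∈-neighbours⁺ G vw)

  colour∈span : ∀ {v a b w} → Spans v a b → Adj G v w → a ≤ c v w × c v w ≤ b
  colour∈span spans vw = Equivalence.from (spans _) (_ , vw , refl)

  colour-spread : ∀ {v w₁ w₂} → Adj G v w₁ → Adj G v w₂ → c v w₂ ≤ c v w₁ + (deg G v ∸ 1)
  colour-spread {v} {w₁} {w₂} vw₁ vw₂ = spread (interval v)
    where
    spread : ∃[ a ] ∃[ b ] Spans v a b → c v w₂ ≤ c v w₁ + (deg G v ∸ 1)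
    spread (a , b , spans) = begin
      c v w₂                  ≤⟨ proj₂ (colour∈span spans vw₂) ⟩
      b                       ≡⟨ sym (m+[n∸m]≡n a≤b) ⟩
      a + (b ∸ a)             ≡⟨ cong (a +_) (sym (cong (_∸ 1) (deg≡span spans a≤b))) ⟩
      a + (deg G v ∸ 1)       ≤⟨ +-monoˡ-≤ (deg G v ∸ 1) (proj₁ (colour∈span spans vw₁)) ⟩
      c v w₁ + (deg G v ∸ 1)  ∎
      where
      open ≤-Reasoning
      a≤b : a ≤ b
      a≤b = uncurry ≤-trans (colour∈span spans vw₁)

  extremes-within : ∀ {v a b} → Spans v a b → a ≤ b →
    ∃[ x ] ∃[ y ] (Adj G v x × Adj G v y × c v y ≡ c v x + (deg G v ∸ 1))
  extremes-within {v} {a} {b} spans a≤b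
    with x , vx , refl ← Equivalence.to (spans a) (≤-refl , a≤b)
       | y , vy , refl ← Equivalence.to (spans b) (a≤b , ≤-refl) =
    x , y , vx , vy ,
      trans (sym (m+[n∸m]≡n a≤b)) (cong (c v x +_) (sym (cong (_∸ 1) (deg≡span spans a≤b))))

  extreme-edges : ∀ v → 1 ≤ deg G v →
    ∃[ x ] ∃[ y ] (Adj G v x × Adj G v y × c v y ≡ c v x + (deg G v ∸ 1))
  extreme-edges v 1≤deg =
    let (a , b , spans) = interval v
        (w , vw)        = has-neighbour G v 1≤deg
    in  extremes-within spans (uncurry ≤-trans (colour∈span spans vw))

  drift : (∀ u v → Adj G u v → Adj G v u) →
          ∀ {x y q r vs} → Walk G x y vs → Adj G x q → Adj G y r →
          c y r ≤ c x q + excess G vs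
  drift symmetric {q = q} {r} (here v) vq vr =
    subst (c v r ≤_) (cong (c v q +_) (sym (+-identityʳ _))) (colour-spread vq vr)
  drift symmetric {x} {y} {q} {r} (step {v = v} {vs = vs} xv walk) xq yr = begin
    c y r                               ≤⟨ drift symmetric walk (symmetric x v xv) yr ⟩
    c v x + excess G vs                 ≡⟨ cong (_+ excess G vs) (sym (c-sym x v xv)) ⟩
    c x v + excess G vs                 ≤⟨ +-monoˡ-≤ (excess G vs) (colour-spread xq xv) ⟩
    c x q + (deg G x ∸ 1) + excess G vs ≡⟨ +-assoc (c x q) _ _ ⟩
    c x q + excess G (x ∷ vs)           ∎
    where open ≤-Reasoning

-- Induced paths

data InducedPath {n} (G : Graph n) : Fin n → Fin n → List (Fin n) → Set where
  trivial : ∀ v → InducedPath G v v (v ∷ [])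
  cons    : ∀ {u v w rest} → Adj G u v → InducedPath G v w (v ∷ rest) →
            All (u ≢_) (v ∷ rest) → All (λ z → G u z ≡ false) rest →
            InducedPath G u w (u ∷ v ∷ rest)

module _ {n : ℕ} (G : Graph n) where

  start∈ : ∀ {v w vs} → InducedPath G v w vs → v ∈ vs
  start∈ (trivial _)    = here refl
  start∈ (cons _ _ _ _) = here refl

  length-inducedPath : ∀ {v w vs} → InducedPath G v w vs → length vs ≡ suc (length vs ∸ 1)
  length-inducedPath (trivial _)    = refl
  length-inducedPath (cons _ _ _ _) = refl

  -- Either u reaches w by an induced path (entering the given one at its
  -- last vertex equal or adjacent to u), or u is off it and adjacent to
  -- none of its vertices.
  shortcut : ∀ {v w vs} (u : Fin n) → InducedPath G v w vs →
             (∃[ vs' ] InducedPath G u w vs') ⊎ All (λ z → u ≢ z × G u z ≡ false) vs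
  shortcut u (trivial v) with u ≟ᶠ v | G u v in uv
  ... | yes refl | _     = inj₁ (_ , trivial u)
  ... | no u≢v   | true  = inj₁ (_ , cons uv (trivial v) (u≢v ∷ []) [])
  ... | no u≢v   | false = inj₂ ((u≢v , uv) ∷ [])
  shortcut u (cons {u = h} hv p h∉ far) with shortcut u p
  ... | inj₁ found = inj₁ found
  ... | inj₂ away with u ≟ᶠ h | G u h in uh
  ...   | yes refl | _     = inj₁ (_ , cons hv p h∉ far)
  ...   | no u≢h   | true  =
    inj₁ (_ , cons uh (cons hv p h∉ far) (u≢h ∷ All.map proj₁ away) (All.map proj₂ away))
  ...   | no u≢h   | false = inj₂ ((u≢h , uh) ∷ away)

  extend : ∀ {u v w vs} → Adj G u v → InducedPath G v w vs → ∃[ vs' ] InducedPath G u w vs'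
  extend {u} uv p with shortcut u p
  ... | inj₁ found = found
  ... | inj₂ away with trans (sym uv) (proj₂ (All.lookup away (start∈ p)))
  ...   | ()

  walk⇒inducedPath : ∀ {u w vs} → Walk G u w vs → ∃[ vs' ] InducedPath G u w vs'
  walk⇒inducedPath (here v)      = _ , trivial v
  walk⇒inducedPath (step uv wlk) = extend uv (proj₂ (walk⇒inducedPath wlk))

  inducedPath⇒walk : ∀ {u w vs} → InducedPath G u w vs → Walk G u w vs
  inducedPath⇒walk (trivial v)     = here v
  inducedPath⇒walk (cons uv p _ _) = step uv (inducedPath⇒walk p)

  inducedPath⇒path : ∀ {u w vs} → InducedPath G u w vs → IsPath G u w vs
  inducedPath⇒path p = inducedPath⇒walk p , unique p
    where
    unique : ∀ {u w vs} → InducedPath G u w vs → Unique vs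
    unique (trivial v)      = [] ∷ []
    unique (cons _ p u∉ _)  = u∉ ∷ unique p

  no-neighbours : ∀ {u L} → All (λ z → G u z ≡ false) L → neighboursIn G u L ≡ 0
  no-neighbours []          = refl
  no-neighbours (uz ∷ far) rewrite uz = no-neighbours far

  module _ (simple : IsSimple G) where

    start-neighbours≤1 : ∀ {u w vs} → InducedPath G u w vs → neighboursIn G u vs ≤ 1
    start-neighbours≤1 (trivial u) rewrite proj₂ simple u = z≤n
    start-neighbours≤1 {u} (cons uv _ _ far) rewrite proj₂ simple u | uv | no-neighbours far = ≤-refl

    path-neighbours≤2 : ∀ {u w vs} → InducedPath G u w vs → All (λ z → neighboursIn G z vs ≤ 2) vs
    path-neighbours≤2 p@(trivial _) = m≤n⇒m≤1+n (start-neighbours≤1 p) ∷ []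
    path-neighbours≤2 p@(cons {u = u} {v = v} {rest = rest} _ q _ far)
      with _ ∷ rest≤2 ← path-neighbours≤2 q =
      m≤n⇒m≤1+n (start-neighbours≤1 p)
      ∷ +-mono-≤ (indicator≤1 (G v u)) (start-neighbours≤1 q)
      ∷ later rest rest≤2 far
      where
      -- a later vertex z is not adjacent to u
      later : ∀ zs → All (λ z → neighboursIn G z (v ∷ rest) ≤ 2) zs →
              All (λ z → G u z ≡ false) zs → All (λ z → neighboursIn G z (u ∷ v ∷ rest) ≤ 2) zs
      later []       []         []         = []
      later (z ∷ zs) (le ∷ les) (uz ∷ uzs) =
        subst (λ b → (if b then 1 else 0) + neighboursIn G z (v ∷ rest) ≤ 2)
              (sym (trans (proj₁ simple z u) uz)) le
        ∷ later zs les uzs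

-- Degrees in T̃

module _ {n : ℕ} (T : Graph n) where

  deg-apex : deg (tilde T) zero ≡ numPendant T
  deg-apex = sum-allFin-suc (λ w → if tilde T zero w then 1 else 0)

  deg-old : ∀ v → deg (tilde T) (suc v) ≡ (if does (deg T v ≟ 1) then 1 else 0) + deg T v
  deg-old v = sum-allFin-suc (λ w → if tilde T (suc v) w then 1 else 0)

  tilde-symmetric : (∀ u v → T u v ≡ T v u) → ∀ u v → Adj (tilde T) u v → Adj (tilde T) v u
  tilde-symmetric symT zero    (suc v) a = a
  tilde-symmetric symT (suc u) zero    a = a
  tilde-symmetric symT (suc u) (suc v) a = trans (symT v u) a

  lift-walk : ∀ {x y vs} → Walk T x y vs → Walk (tilde T) (suc x) (suc y) (map suc vs)
  lift-walk (here v)      = here (suc v)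
  lift-walk (step xv wlk) = step xv (lift-walk wlk)

  -- A vertex with at most two neighbours on vs has, in T̃, at most one
  -- more edge than those leaving vs: a pendant vertex has no neighbour
  -- besides its one edge and the apex.
  old-excess≤ : ∀ vs v → neighboursIn T v vs ≤ 2 → deg (tilde T) (suc v) ∸ 1 ≤ 1 + outside T vs v
  old-excess≤ vs v on≤2 =
    subst (λ d → d ∸ 1 ≤ 1 + outside T vs v) (sym (deg-old v))
      (arithmetic (deg T v) (outside T vs v)
        (≤-trans (deg≤inside+outside T v vs) (+-monoˡ-≤ (outside T vs v) on≤2)))
    where
    arithmetic : ∀ d o → d ≤ 2 + o → (if does (d ≟ 1) then 1 else 0) + d ∸ 1 ≤ 1 + o
    arithmetic 0             o _  = z≤n
    arithmetic 1             o _  = s≤s z≤n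
    arithmetic (suc (suc d)) o le = ∸-monoˡ-≤ 1 le

  path-excess≤ : IsSimple T → ∀ {x y vs} → InducedPath T x y vs →
                 excess (tilde T) (map suc vs) ≤ suc (Lpath T vs)
  path-excess≤ simple {vs = vs} p = begin
    excess (tilde T) (map suc vs)
      ≡⟨ cong sum (sym (map-∘ vs)) ⟩
    sum (map (λ v → deg (tilde T) (suc v) ∸ 1) vs)
      ≤⟨ sum-≤-+ _ _ _ vs (All.map (old-excess≤ vs _) (path-neighbours≤2 T simple p)) ⟩
    sum (map (λ _ → 1) vs) + sum (map (outside T vs) vs)
      ≡⟨ cong (_+ sum (map (outside T vs) vs)) (trans (sum-ones vs) (length-inducedPath T p)) ⟩
    suc (Lpath T vs) ∎
    where open ≤-Reasoning

theorem9 : (n : ℕ) (T : Graph n) → 2 ≤ n → IsTree T →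
    (∀ (u v : Fin n) d → Pendant T u → Pendant T v → Dist T u v d → 2 ∣ d) →
    (m : ℕ) → IsM T m → m + 2 < numPendant T →
    ¬ InN (tilde T)
theorem9 n T _ (simple , connected , _) _ m (_ , L≤m) m+2<F (t , _ , col)
  -- the apex has degree |F(T)| ≥ 1; take its edges of extreme colour
  with extreme-edges zero (subst (1 ≤_) (sym (deg-apex T)) (≤-trans (s≤s z≤n) m+2<F))
  where open ColourFacts col
-- the apex is not adjacent to itself
... | zero  , _     , () , _  , _
... | suc _ , zero  , _  , () , _
... | suc x , suc y , ax , ay , spread = <⇒≱ m+2<F F≤m+2
  where
  open IntervalColoring col using (c) renaming (sym to c-sym)
  open ColourFacts col using (drift)
  open ≤-Reasoning

  path : ∃[ vs ] InducedPath T x y vs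
  path = walk⇒inducedPath T (proj₂ (connected x y))
  vs : List (Fin n)
  vs = proj₁ path
  P : InducedPath T x y vs
  P = proj₂ path

  apex-drift : c zero (suc y) ≤ c zero (suc x) + suc m
  apex-drift = begin
    c zero (suc y)                         ≡⟨ c-sym zero (suc y) ay ⟩
    c (suc y) zero                         ≤⟨ drift (tilde-symmetric T (proj₁ simple))
                                                (lift-walk T (inducedPath⇒walk T P)) ax ay ⟩
    c (suc x) zero + excess (tilde T) (map suc vs)
                                           ≡⟨ cong (_+ _) (sym (c-sym zero (suc x) ax)) ⟩
    c zero (suc x) + excess (tilde T) (map suc vs)
                                           ≤⟨ +-monoʳ-≤ _ (path-excess≤ T simple P) ⟩
    c zero (suc x) + suc (Lpath T vs)      ≤⟨ +-monoʳ-≤ _ (s≤s (L≤m x y _ (vs , inducedPath⇒path T P , refl))) ⟩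
    c zero (suc x) + suc m                 ∎

  F≤m+2 : numPendant T ≤ m + 2
  F≤m+2 = begin
    numPendant T                       ≡⟨ sym (deg-apex T) ⟩
    deg (tilde T) zero                 ≤⟨ m≤n+m∸n _ 1 ⟩
    1 + (deg (tilde T) zero ∸ 1)       ≤⟨ s≤s (+-cancelˡ-≤ (c zero (suc x)) _ _
                                          (subst (_≤ c zero (suc x) + suc m) spread apex-drift)) ⟩
    2 + m                              ≡⟨ +-comm 2 m ⟩
    m + 2                              ∎
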